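{- Let $N = q^k n^2$ be an odd perfect number given in Eulerian form. Then $\gcd\big(n, \sigma(q^k)/2\big) \neq 1$.
   Context: $\sigma(x)$ denotes the sum of the positive divisors of $x$. A positive integer $N$ is perfect if $\sigma(N)=2N$. An odd perfect number $N$ is said to be given in Eulerian form $N = q^k n^2$ if $q$ is a prime (the special prime), $k$ and $n$ are positive integers, $q \equiv k \equiv 1 \pmod 4$, and $\gcd(q,n)=1$. -}

module Defs where

open import Data.Nat using (ℕ; zero; suc; _+_; _*_; _^_; _%_)
open import Data.Nat.Divisibility using (_∣?_)
open import Relation.Nullary using (yes; no)

σ-upto : ℕ → ℕ → ℕ
σ-upto x zero = 0
σ-upto x (suc m) with suc m ∣? x
... | yes _ = suc m + σ-upto x m
... | no  _ = σ-upto x m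

-- σ x = sum of the positive divisors of x  (σ 0 = 0 by convention; unused)
σ : ℕ → ℕ
σ x = σ-upto x x

Perfect : ℕ → Set
Perfect N = σ N ≡ 2 * N
  where open import Relation.Binary.PropositionalEquality using (_≡_)

-- The divisor sum is multiplicative across a prime power, so perfection gives
-- σ(q^k) σ(n²) = 2 q^k n².  Since q and k are odd, σ(q^k) = 1 + q + ⋯ + q^k is
-- even; write it as 2t.  Then t σ(n²) = q^k n².  If t were coprime to n it
-- would divide q^k; but t also divides 1 + q(1 + ⋯ + q^(k-1)) and so is coprime
-- to q.  Hence t = 1, i.e. 1 + q + ⋯ + q^k = 2, which forces q = 1.
module Submission where

open import Data.Nat
open import Data.Nat.Coprimality as Coprime using (Coprime; coprime-divisor; gcd≡1⇒coprime)
open import Data.Nat.DivMod using (m≡m%n+[m/n]*n)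
open import Data.Nat.Divisibility
open import Data.Nat.GCD using (gcd)
open import Data.Nat.Primality using (Prime; prime⇒nonZero; prime⇒nonTrivial; prime⇒irreducible)
open import Data.Nat.Properties
open import Data.Nat.Tactic.RingSolver using (solve-∀)
open import Algebra.Properties.CommutativeSemigroup +-commutativeSemigroup using (interchange)
open import Data.Product using (_,_)
open import Data.Sum using (inj₁; inj₂)
open import Function using (_∘_)
open import Relation.Binary.PropositionalEquality
open import Relation.Nullary using (yes; no; contradiction)
open import Defs

private
  variable
    a b c d k m n p x y : ℕ

coprime-* : Coprime a b → Coprime a c → Coprime a (b * c)
coprime-* a⊥b a⊥c (d∣a , d∣bc) =
  a⊥c (d∣a , coprime-divisor (λ (e∣d , e∣b) → a⊥b (∣-trans e∣d d∣a , e∣b)) d∣bc)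

coprime-^ : Coprime a b → ∀ k → Coprime a (b ^ k)
coprime-^ a⊥b zero    (_ , d∣1) = ∣1⇒≡1 d∣1
coprime-^ a⊥b (suc k) = coprime-* a⊥b (coprime-^ a⊥b k)

coprime-∣ : c ∣ a → Coprime a b → Coprime c b
coprime-∣ c∣a a⊥b (d∣c , d∣b) = a⊥b (∣-trans d∣c c∣a , d∣b)

coprime∧∣*⇒≡1 : Coprime d a → Coprime d b → d ∣ a * b → d ≡ 1
coprime∧∣*⇒≡1 d⊥a d⊥b d∣ab = coprime-* d⊥a d⊥b (∣-refl , d∣ab)

prime⇒≢1 : Prime p → p ≢ 1
prime⇒≢1 p-prime = nonTrivial⇒≢1 {{prime⇒nonTrivial p-prime}}

prime∧∤⇒coprime : Prime p → p ∤ n → Coprime p n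
prime∧∤⇒coprime p-prime p∤n (d∣p , d∣n) with prime⇒irreducible p-prime d∣p
... | inj₁ d≡1 = d≡1
... | inj₂ refl = contradiction d∣n p∤n

∤-between-multiples : c * k < d → d < c * suc k → c ∤ d
∤-between-multiples {c} {k} lo hi (divides e refl) =
  <⇒≱ (*-cancelˡ-< c k e (subst (c * k <_) (*-comm e c) lo))
      (s≤s⁻¹ (*-cancelˡ-< c e (suc k) (subst (_< c * suc k) (*-comm e c) hi)))

sumTo : (ℕ → ℕ) → ℕ → ℕ
sumTo f zero    = 0
sumTo f (suc m) = f (suc m) + sumTo f m

sumTo-cong : ∀ {f g} → (∀ d → f d ≡ g d) → ∀ m → sumTo f m ≡ sumTo g m
sumTo-cong f≗g zero    = refl
sumTo-cong f≗g (suc m) = cong₂ _+_ (f≗g (suc m)) (sumTo-cong f≗g m)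

sumTo-+ : ∀ f g m → sumTo (λ d → f d + g d) m ≡ sumTo f m + sumTo g m
sumTo-+ f g zero    = refl
sumTo-+ f g (suc m) =
  trans (cong (f (suc m) + g (suc m) +_) (sumTo-+ f g m))
        (interchange (f (suc m)) (g (suc m)) (sumTo f m) (sumTo g m))

sumTo-vanishing : ∀ {f} → m ≤ n → (∀ d → m < d → d ≤ n → f d ≡ 0) → sumTo f n ≡ sumTo f m
sumTo-vanishing {n = zero} z≤n _ = refl
sumTo-vanishing {n = suc n} {f = f} m≤1+n vanish with m≤n⇒m<n∨m≡n m≤1+n
... | inj₂ refl = refl
... | inj₁ (s≤s m≤n) =
  trans (cong (_+ sumTo f n) (vanish (suc n) (s≤s m≤n) ≤-refl))
        (sumTo-vanishing m≤n (λ d m<d d≤n → vanish d m<d (m≤n⇒m≤1+n d≤n)))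

sumTo-multiples : ∀ c .{{_ : NonZero c}} {f u} → (∀ d → c ∤ d → f d ≡ 0) →
                  (∀ e → f (c * e) ≡ c * u e) → ∀ k → sumTo f (c * k) ≡ c * sumTo u k
sumTo-multiples c _ _ zero = trans (cong (sumTo _) (*-zeroʳ c)) (sym (*-zeroʳ c))
sumTo-multiples c@(suc c′) {f} {u} vanish scale (suc k) = begin
  sumTo f (c * suc k)                   ≡⟨ cong (sumTo f) (*-suc c k) ⟩
  f (c + c * k) + sumTo f (c′ + c * k)  ≡⟨ cong₂ _+_ top (sumTo-vanishing (m≤n+m (c * k) c′) gap) ⟩
  c * u (suc k) + sumTo f (c * k)       ≡⟨ cong (c * u (suc k) +_) (sumTo-multiples c vanish scale k) ⟩
  c * u (suc k) + c * sumTo u k         ≡⟨ *-distribˡ-+ c (u (suc k)) (sumTo u k) ⟨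
  c * sumTo u (suc k)                   ∎
  where
  open ≡-Reasoning
  top : f (c + c * k) ≡ c * u (suc k)
  top = trans (cong f (sym (*-suc c k))) (scale (suc k))
  gap : ∀ d → c * k < d → d ≤ c′ + c * k → f d ≡ 0
  gap d lo hi = vanish d (∤-between-multiples lo (subst (d <_) (sym (*-suc c k)) (s≤s hi)))

divisorTerm : ℕ → ℕ → ℕ
divisorTerm x d with d ∣? x
... | yes _ = d
... | no  _ = 0

divisorTerm-∣ : d ∣ x → divisorTerm x d ≡ d
divisorTerm-∣ {d} {x} d∣x with d ∣? x
... | yes _   = refl
... | no  d∤x = contradiction d∣x d∤x

divisorTerm-∤ : d ∤ x → divisorTerm x d ≡ 0
divisorTerm-∤ {d} {x} d∤x with d ∣? x
... | yes d∣x = contradiction d∣x d∤x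
... | no  _   = refl

divisorTerm-* : ∀ c .{{_ : NonZero c}} m e → divisorTerm (c * m) (c * e) ≡ c * divisorTerm m e
divisorTerm-* c m e with e ∣? m
... | yes e∣m = divisorTerm-∣ (*-monoʳ-∣ c e∣m)
... | no  e∤m = trans (divisorTerm-∤ (e∤m ∘ *-cancelˡ-∣ c)) (sym (*-zeroʳ c))

σ-upto≡sumTo : ∀ x m → σ-upto x m ≡ sumTo (divisorTerm x) m
σ-upto≡sumTo x zero = refl
σ-upto≡sumTo x (suc m) with suc m ∣? x
... | yes _ = cong (suc m +_) (σ-upto≡sumTo x m)
... | no  _ = σ-upto≡sumTo x m

σ≡sumTo : .{{_ : NonZero x}} → x ≤ n → σ x ≡ sumTo (divisorTerm x) n
σ≡sumTo {x} x≤n = trans (σ-upto≡sumTo x x)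
  (sym (sumTo-vanishing x≤n (λ d x<d _ → divisorTerm-∤ (>⇒∤ x<d))))

freshDivisorTerm : ℕ → ℕ → ℕ → ℕ
freshDivisorTerm x y d with d ∣? x
... | yes _ = 0
... | no  _ = divisorTerm y d

freshDivisorTerm-∤ : d ∤ x → freshDivisorTerm x y d ≡ divisorTerm y d
freshDivisorTerm-∤ {d} {x} d∤x with d ∣? x
... | yes d∣x = contradiction d∣x d∤x
... | no  _   = refl

divisorTerm-split : x ∣ y → ∀ d → divisorTerm y d ≡ divisorTerm x d + freshDivisorTerm x y d
divisorTerm-split {x} {y} x∣y d with d ∣? x
... | yes d∣x = trans (divisorTerm-∣ (∣-trans d∣x x∣y)) (sym (+-identityʳ d))
... | no  _   = refl

σ-split : .{{_ : NonZero x}} .{{_ : NonZero y}} → x ∣ y →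
          σ y ≡ σ x + sumTo (freshDivisorTerm x y) y
σ-split {x} {y} x∣y = begin
  σ y                                           ≡⟨ σ-upto≡sumTo y y ⟩
  sumTo (divisorTerm y) y                       ≡⟨ sumTo-cong (divisorTerm-split x∣y) y ⟩
  sumTo (λ d → divisorTerm x d + fresh d) y     ≡⟨ sumTo-+ (divisorTerm x) fresh y ⟩
  sumTo (divisorTerm x) y + sumTo fresh y       ≡⟨ cong (_+ sumTo fresh y) (σ≡sumTo (∣⇒≤ x∣y)) ⟨
  σ x + sumTo fresh y                           ∎
  where
  open ≡-Reasoning
  fresh : ℕ → ℕ
  fresh = freshDivisorTerm x y

geomSum : ℕ → ℕ → ℕ
geomSum p zero    = 1
geomSum p (suc k) = geomSum p k + p ^ suc k

module _ {p} (p-prime : Prime p) where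

  private instance
    p≢0 : NonZero p
    p≢0 = prime⇒nonZero p-prime

  ∣p^[1+k]*m∧∤p^k*m⇒p^[1+k]∣ : ∀ k m → d ∣ p ^ suc k * m → d ∤ p ^ k * m → p ^ suc k ∣ d
  ∣p^[1+k]*m∧∤p^k*m⇒p^[1+k]∣ {d} k m (divides t eq) d∤p^k*m with p ∣? t
  ... | yes (divides s refl) = contradiction (divides s (*-cancelˡ-≡ (p ^ k * m) (s * d) p (begin
    p * (p ^ k * m)  ≡⟨ *-assoc p (p ^ k) m ⟨
    p ^ suc k * m    ≡⟨ eq ⟩
    s * p * d        ≡⟨ cong (_* d) (*-comm s p) ⟩
    p * s * d        ≡⟨ *-assoc p s d ⟩
    p * (s * d)      ∎))) d∤p^k*m
    where open ≡-Reasoning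
  ... | no  p∤t = coprime-divisor p^[1+k]⊥t (subst (p ^ suc k ∣_) eq (m∣m*n m))
    where
    p^[1+k]⊥t : Coprime (p ^ suc k) t
    p^[1+k]⊥t = Coprime.sym (coprime-^ (Coprime.sym (prime∧∤⇒coprime p-prime p∤t)) (suc k))

  p^[1+k]*e∤p^k*m : p ∤ m → ∀ k e → p ^ suc k * e ∤ p ^ k * m
  p^[1+k]*e∤p^k*m {m} p∤m k e p^[1+k]*e∣p^k*m = p∤m (m*n∣⇒m∣ p e (*-cancelˡ-∣ (p ^ k) {{m^n≢0 p k}}
    (subst (_∣ p ^ k * m) (trans (cong (_* e) (*-comm p (p ^ k))) (*-assoc (p ^ k) p e)) p^[1+k]*e∣p^k*m)))

  -- The divisors of p^(k+1) m that do not divide p^k m are exactly p^(k+1) e with e ∣ m.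
  σ-p^[1+k]*m : p ∤ m → ∀ k → σ (p ^ suc k * m) ≡ σ (p ^ k * m) + p ^ suc k * σ m
  σ-p^[1+k]*m {m} p∤m k = begin
    σ (P * m)                                ≡⟨ σ-split X∣Y ⟩
    σ X + sumTo (freshDivisorTerm X Y) Y     ≡⟨ cong (σ X +_) (sumTo-multiples P fresh-vanishes fresh-multiple m) ⟩
    σ X + P * sumTo (divisorTerm m) m        ≡⟨ cong (λ s → σ X + P * s) (σ-upto≡sumTo m m) ⟨
    σ X + P * σ m                            ∎
    where
    open ≡-Reasoning
    P X Y : ℕ
    P = p ^ suc k
    X = p ^ k * m
    Y = P * m
    instance
      m≢0 : NonZero m
      m≢0 = ≢-nonZero λ { refl → p∤m (p ∣0) }
      p^k≢0 : NonZero (p ^ k)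
      p^k≢0 = m^n≢0 p k
      P≢0 : NonZero P
      P≢0 = m^n≢0 p (suc k)
      X≢0 : NonZero X
      X≢0 = m*n≢0 (p ^ k) m
      Y≢0 : NonZero Y
      Y≢0 = m*n≢0 P m
    X∣Y : X ∣ Y
    X∣Y = *-monoˡ-∣ m (n∣m*n p)
    fresh-vanishes : ∀ d → P ∤ d → freshDivisorTerm X Y d ≡ 0
    fresh-vanishes d P∤d with d ∣? X
    ... | yes _   = refl
    ... | no  d∤X = divisorTerm-∤ (λ d∣Y → P∤d (∣p^[1+k]*m∧∤p^k*m⇒p^[1+k]∣ k m d∣Y d∤X))
    fresh-multiple : ∀ e → freshDivisorTerm X Y (P * e) ≡ P * divisorTerm m e
    fresh-multiple e = trans (freshDivisorTerm-∤ (p^[1+k]*e∤p^k*m p∤m k e)) (divisorTerm-* P m e)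

  σ-p^k*m : p ∤ m → ∀ k → σ (p ^ k * m) ≡ geomSum p k * σ m
  σ-p^k*m {m} p∤m zero    = trans (cong σ (*-identityˡ m)) (sym (*-identityˡ (σ m)))
  σ-p^k*m {m} p∤m (suc k) = begin
    σ (p ^ suc k * m)                      ≡⟨ σ-p^[1+k]*m p∤m k ⟩
    σ (p ^ k * m) + p ^ suc k * σ m        ≡⟨ cong (_+ p ^ suc k * σ m) (σ-p^k*m p∤m k) ⟩
    geomSum p k * σ m + p ^ suc k * σ m    ≡⟨ *-distribʳ-+ (σ m) (geomSum p k) (p ^ suc k) ⟨
    geomSum p (suc k) * σ m                ∎
    where open ≡-Reasoning

  σ-p^k : ∀ k → σ (p ^ k) ≡ geomSum p k
  σ-p^k k = begin
    σ (p ^ k)          ≡⟨ cong σ (*-identityʳ (p ^ k)) ⟨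
    σ (p ^ k * 1)      ≡⟨ σ-p^k*m p∤1 k ⟩
    geomSum p k * 1    ≡⟨ *-identityʳ (geomSum p k) ⟩
    geomSum p k        ∎
    where
    open ≡-Reasoning
    p∤1 : p ∤ 1
    p∤1 = prime⇒≢1 p-prime ∘ ∣1⇒≡1

geomSum-suc : ∀ p k → geomSum p (suc k) ≡ 1 + p * geomSum p k
geomSum-suc p zero    = refl
geomSum-suc p (suc k) = begin
  geomSum p (suc k) + p ^ suc (suc k)      ≡⟨ cong (_+ p ^ suc (suc k)) (geomSum-suc p k) ⟩
  1 + p * geomSum p k + p * p ^ suc k      ≡⟨ cong suc (*-distribˡ-+ p (geomSum p k) (p ^ suc k)) ⟨
  1 + p * (geomSum p k + p ^ suc k)        ∎
  where open ≡-Reasoning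

geomSum-even : 2 ∣ suc p → 2 ∣ suc k → 2 ∣ geomSum p k
geomSum-even {p} {zero}        _     2∣1   = contradiction (∣1⇒≡1 2∣1) λ ()
geomSum-even {p} {suc zero}    2∣1+p _     = subst (λ q → 2 ∣ suc q) (sym (*-identityʳ p)) 2∣1+p
geomSum-even {p} {suc (suc k)} 2∣1+p 2∣3+k = subst (2 ∣_) (sym two-steps)
  (∣m∣n⇒∣m+n 2∣1+p (∣n⇒∣m*n (p * p) (geomSum-even 2∣1+p (∣m+n∣m⇒∣n 2∣3+k ∣-refl))))
  where
  two-steps : geomSum p (suc (suc k)) ≡ suc p + p * p * geomSum p k
  two-steps = begin
    geomSum p (suc (suc k))          ≡⟨ geomSum-suc p (suc k) ⟩
    1 + p * geomSum p (suc k)        ≡⟨ cong (λ g → 1 + p * g) (geomSum-suc p k) ⟩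
    1 + p * (1 + p * geomSum p k)    ≡⟨ expand p (geomSum p k) ⟩
    suc p + p * p * geomSum p k      ∎
    where
    open ≡-Reasoning
    expand : ∀ a b → 1 + a * (1 + a * b) ≡ suc a + a * a * b
    expand = solve-∀

geomSum-coprime : ∀ p k → Coprime (geomSum p k) p
geomSum-coprime p zero    (d∣1 , _)     = ∣1⇒≡1 d∣1
geomSum-coprime p (suc k) {d} (d∣G , d∣p) = ∣1⇒≡1 (∣m+n∣m⇒∣n
  (subst (d ∣_) (trans (geomSum-suc p k) (+-comm 1 (p * geomSum p k))) d∣G)
  (∣m⇒∣m*n (geomSum p k) d∣p))

geomSum≢2 : p ≢ 1 → 0 < k → geomSum p k ≢ 2
geomSum≢2 {p} {suc k} p≢1 _ G≡2 =
  p≢1 (m*n≡1⇒m≡1 p (geomSum p k) (suc-injective (trans (sym (geomSum-suc p k)) G≡2)))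

n%4≡1⇒2∣1+n : ∀ n → n % 4 ≡ 1 → 2 ∣ suc n
n%4≡1⇒2∣1+n n n%4≡1 = divides (1 + n / 4 * 2)
  (cong suc (trans (m≡m%n+[m/n]*n n 4) (cong₂ _+_ n%4≡1 (sym (*-assoc (n / 4) 2 2)))))

theorem6 : (N q k n : ℕ) → 0 < k → 0 < n → N % 2 ≡ 1 → Perfect N → Prime q
    → N ≡ q ^ k * (n * n) → q % 4 ≡ 1 → k % 4 ≡ 1 → gcd q n ≡ 1
    → gcd n (σ (q ^ k) / 2) ≢ 1
theorem6 N q k n 0<k _ _ perfect q-prime refl q%4≡1 k%4≡1 gcd[q,n]≡1 gcd[n,σ/2]≡1 =
  geomSum≢2 (prime⇒≢1 q-prime) 0<k (trans (m∣n⇒n≡quotient*m 2∣G) (cong (_* 2) t≡1))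
  where
  q⊥n : Coprime q n
  q⊥n = gcd≡1⇒coprime gcd[q,n]≡1
  q∤n² : q ∤ n * n
  q∤n² q∣n² = prime⇒≢1 q-prime (coprime-* q⊥n q⊥n (∣-refl , q∣n²))
  2∣G : 2 ∣ geomSum q k
  2∣G = geomSum-even (n%4≡1⇒2∣1+n q q%4≡1) (n%4≡1⇒2∣1+n k k%4≡1)
  t : ℕ
  t = quotient 2∣G
  σ[q^k]/2≡t : σ (q ^ k) / 2 ≡ t
  σ[q^k]/2≡t = trans (cong (_/ 2) (σ-p^k q-prime k)) (n/m≡quotient 2∣G)
  t⊥n : Coprime t n
  t⊥n = Coprime.sym (gcd≡1⇒coprime (trans (cong (gcd n) (sym σ[q^k]/2≡t)) gcd[n,σ/2]≡1))
  t⊥q^k : Coprime t (q ^ k)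
  t⊥q^k = coprime-^ (coprime-∣ (quotient-∣ 2∣G) (geomSum-coprime q k)) k
  t∣q^k*n² : t ∣ q ^ k * (n * n)
  t∣q^k*n² = *-cancelʳ-∣ 2 (subst₂ _∣_ (m∣n⇒n≡quotient*m 2∣G) σ-eq (m∣m*n (σ (n * n))))
    where
    σ-eq : geomSum q k * σ (n * n) ≡ q ^ k * (n * n) * 2
    σ-eq = trans (sym (σ-p^k*m q-prime q∤n² k)) (trans perfect (*-comm 2 (q ^ k * (n * n))))
  t≡1 : t ≡ 1
  t≡1 = coprime∧∣*⇒≡1 t⊥q^k (coprime-* t⊥n t⊥n) t∣q^k*n²
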